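{- Let $\alpha$ be a countable limit ordinal and $\mathcal F$ an $\alpha$-uniform family on a final segment $S$ of $\mathbb N$. If $M\in S^{[\infty]}$ is $\mathcal F$-adequate, then there are ordinals $\beta_n<\alpha$ and finite sets $u_n\subseteq M$ ($n\in\mathbb N$) such that, for every $n$, $M/u_n$ is $\mathcal F_{u_n}$-adequate and $\mathcal F_{u_n}$ is $(\beta_n+1)$-uniform on $M/u_n$, and $\alpha=\sup\{\beta_n: n\in\mathbb N\}$.
   Context: Notation: $S^{[\infty]}$ is the set of infinite subsets of $S$; a final segment is $\{n,n+1,\dots\}$; $\max(\emptyset)=-1$; $A/k=\{n\in A:k<n\}$, $A/u=A/\max(u)$ for finite $u$. For finite $s$ and $t\subseteq\mathbb N$: $s\sqsubseteq t$ means $s=t\cap\{0,\dots,n\}$ for some $n$. For $\mathcal F\subseteq[\mathbb N]^{<\infty}$ and finite $u$: $\mathcal F_u=\{s: u\cup s\in\mathcal F,\ \max(u)<\min(s)\}$. Uniform families on an infinite $M\subseteq\mathbb N$: $\{\emptyset\}$ is the unique $0$-uniform family; $\mathcal F$ is $(\beta+1)$-uniform on $M$ if $\mathcal F_{\{n\}}$ is $\beta$-uniform on $M/n$ for all $n\in M$; for limit $\beta$, $\mathcal F$ is $\beta$-uniform on $M$ if there is an increasing sequence $(\beta_k)_{k\in M}$ converging to $\beta$ with $\mathcal F_{\{k\}}$ $\beta_k$-uniform on $M/k$ for all $k\in M$. Uniform families are fronts; for a uniform family $\mathcal G$ on a final segment $T$ and $n\in T$, $t^{\mathcal G}_n$ is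 the unique element of $\mathcal G$ with $t^{\mathcal G}_n\sqsubseteq\{n,n+1,\dots\}$. $\mathcal F$-adequate sets: for $\mathcal F$ $\gamma$-uniform on a final segment $S$, $\gamma\ge2$, $M\in S^{[\infty]}$, define $M(\mathcal F)\subseteq M$ recursively: (i) if $\gamma=2$, $M(\mathcal F)=\{n\in M: t^{\mathcal F}_{n+1}\subseteq M\}$; (ii) if $\gamma=\delta+1\ge3$, $M(\mathcal F)=\{n\in M: t^{\mathcal F}_{n+1}\subseteq M,\ M/n\text{ is }\mathcal F_{\{n\}}\text{ -adequate and }(M/n)(\mathcal F_{\{n\}})\text{ is infinite}\}$; in (i),(ii) $M$ is $\mathcal F$-adequate iff $M(\mathcal F)\ne\emptyset$. (iii) If $\gamma$ is a limit, $M(\mathcal F)=M$ and, with $(\gamma_n)$ the increasing sequence from the definition of $\gamma$-uniform, $M$ is $\mathcal F$-adequate iff for every $n$ there is a nonempty finite $v\subseteq M$ with $\mathcal F_v$ $\delta$-uniform for some $\delta\ge\gamma_n$ and $M/v$ $\mathcal F_v$-adequate. -}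

module Defs where

open import Data.Nat using (ℕ; suc; _⊔_) renaming (_<_ to _<ℕ_; _≤_ to _≤ℕ_)
open import Data.List using (List; []; _∷_; _++_; map; upTo; foldr)
open import Data.List.Relation.Unary.All using (All)
open import Data.List.Relation.Unary.Linked using (Linked)
open import Data.Product using (Σ; ∃; _×_)
open import Data.Empty using (⊥)
open import Level using (Level)
open import Relation.Nullary using (¬_)
open import Relation.Binary.PropositionalEquality using (_≡_)

-- Countable ordinals as Brouwer trees, with the standard inductive order

data Ord : Set where
  zero : Ord
  suc  : Ord → Ord
  lim  : (ℕ → Ord) → Ord

infix 4 _≤_ _<_ _≈_

data _≤_ : Ord → Ord → Set where
  ≤-zero     : ∀ {x} → zero ≤ x
  ≤-suc      : ∀ {x y} → x ≤ y → suc x ≤ suc y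
  ≤-cocone   : ∀ {x f} k → x ≤ f k → x ≤ lim f
  ≤-limiting : ∀ {f x} → (∀ k → f k ≤ x) → lim f ≤ x
  ≤-trans    : ∀ {x y z} → x ≤ y → y ≤ z → x ≤ z

_<_ : Ord → Ord → Set
x < y = suc x ≤ y

_≈_ : Ord → Ord → Set
x ≈ y = (x ≤ y) × (y ≤ x)

two : Ord
two = suc (suc zero)

IsLimit : Ord → Set
IsLimit α = (¬ (α ≈ zero)) × (∀ β → ¬ (α ≈ suc β))

IsSupOn : (ℕ → Set) → (ℕ → Ord) → Ord → Set
IsSupOn M f β = (∀ k → M k → f k ≤ β) × (∀ γ → (∀ k → M k → f k ≤ γ) → β ≤ γ)

Subset : Set₁
Subset = ℕ → Set

Infinite : ∀ {ℓ} → (ℕ → Set ℓ) → Set ℓ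
Infinite M = ∀ k → ∃ λ n → k <ℕ n × M n

Seg : ℕ → Subset
Seg s0 m = s0 ≤ℕ m

-- finite subsets of ℕ are represented by strictly increasing lists
Increasing : List ℕ → Set
Increasing = Linked _<ℕ_

-- families of finite sets (only strictly increasing lists are meaningful)
Fam : Set₁
Fam = List ℕ → Set

-- max(u)+1, with max(∅) = -1, so maxSuc [] = 0
maxSuc : List ℕ → ℕ
maxSuc = foldr (λ a r → suc a ⊔ r) 0

_/_ : Subset → List ℕ → Subset
(A / u) m = A m × All (_<ℕ m) u

_⟨_⟩ : Fam → List ℕ → Fam
(F ⟨ u ⟩) s = F (u ++ s) × All (λ a → All (a <ℕ_) s) u

interval : ℕ → ℕ → List ℕ
interval n k = map (n Data.Nat.+_) (upTo k)

-- "t^F_n ⊆ M": the (unique) element of F that is an initial segment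
-- of {n, n+1, ...} is contained in M
TSub : Fam → ℕ → Subset → Set
TSub F n M = ∃ λ k → F (interval n k) × All M (interval n k)

data Uniform : Subset → Fam → Ord → Set₁ where
  uni0 : ∀ {M F β} → β ≈ zero →
         (∀ s → F s → s ≡ []) → F [] →
         Uniform M F β
  uniS : ∀ {M F β} (γ : Ord) → β ≈ suc γ → ¬ F [] →
         (∀ n → M n → Uniform (M / (n ∷ [])) (F ⟨ n ∷ [] ⟩) γ) →
         Uniform M F β
  uniL : ∀ {M F β} (βs : ℕ → Ord) → IsLimit β → ¬ F [] →
         (∀ k l → M k → M l → k <ℕ l → βs k < βs l) →
         IsSupOn M βs β →
         (∀ k → M k → Uniform (M / (k ∷ [])) (F ⟨ k ∷ [] ⟩) (βs k)) →
         Uniform M F β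

-- F-adequate sets.  InAdq γ s0 F M n  means  n ∈ M(F), where F is
-- γ-uniform on the final segment Seg s0;  Adequate γ s0 F M  means M is
-- F-adequate.

data InAdq : Ord → ℕ → Fam → Subset → ℕ → Set₁
data Adequate : Ord → ℕ → Fam → Subset → Set₁

data InAdq where
  in2 : ∀ {γ s0 F M n} → γ ≈ two → M n → TSub F (suc n) M →
        InAdq γ s0 F M n
  inS : ∀ {γ s0 F M n} (δ : Ord) → γ ≈ suc δ → two ≤ δ →
        M n → TSub F (suc n) M →
        Adequate δ (suc n) (F ⟨ n ∷ [] ⟩) (M / (n ∷ [])) →
        Infinite (InAdq δ (suc n) (F ⟨ n ∷ [] ⟩) (M / (n ∷ []))) →
        InAdq γ s0 F M n
  inL : ∀ {γ s0 F M n} → IsLimit γ → M n → InAdq γ s0 F M n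

data Adequate where
  ad2 : ∀ {γ s0 F M} n → γ ≈ two → InAdq γ s0 F M n → Adequate γ s0 F M
  adS : ∀ {γ s0 F M} n (δ : Ord) → γ ≈ suc δ → two ≤ δ →
        InAdq γ s0 F M n → Adequate γ s0 F M
  adL : ∀ {γ s0 F M} → IsLimit γ →
        (∀ ξ → ξ < γ →
          Σ (List ℕ) λ v → ¬ (v ≡ []) × Increasing v × All M v ×
            Σ Ord λ δ → ξ ≤ δ ×
              Uniform (Seg (s0 ⊔ maxSuc v)) (F ⟨ v ⟩) δ ×
              Adequate δ (s0 ⊔ maxSuc v) (F ⟨ v ⟩) (M / v)) →
        Adequate γ s0 F M

module Submission where

-- The heart of the proof is a descent lemma: if G is δ-uniform on a
-- final segment and N ⊆ it is G-adequate, then for every ξ < δ there is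
-- a finite u ⊆ N and ξ ≤ β < δ such that G_u is (β+1)-uniform on N/u and
-- N/u is G_u-adequate.  At a successor rank u = ∅ works; at a limit
-- rank, adequacy supplies v with G_v of rank δ_v > ξ, and we descend in
-- G_v and prepend v.  That δ_v < δ follows from the fact that passing
-- to G_v (v ≠ ∅) strictly lowers the rank of a uniform family.
-- The theorem applies the descent to the fundamental sequence of α.

open import Defs
open import Data.Nat using (ℕ; _⊔_) renaming (_≤_ to _≤ℕ_)
open import Data.List using (List)
open import Data.List.Relation.Unary.All using (All)
open import Data.Product using (Σ; _×_)
open import Data.Unit using (⊤)

open import Data.Nat using (suc; _+_; _∸_; z≤n; s≤s) renaming (_<_ to _<ℕ_)
import Data.Nat.Properties as ℕₚ
open import Data.List using ([]; _∷_; _++_)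
open import Data.List.Properties using (++-assoc)
open import Data.List.Relation.Unary.All as All using ([]; _∷_)
import Data.List.Relation.Unary.All.Properties as Allₚ
open import Data.List.Relation.Unary.Linked as Linked using ([]; [-]; _∷_)
open import Data.Product using (_,_; proj₁; proj₂; ∃)
open import Data.Unit using (tt)
open import Data.Empty using (⊥; ⊥-elim)
open import Relation.Nullary using (¬_)
open import Relation.Binary.PropositionalEquality using (_≡_; refl; sym; trans; subst; cong)
open import Function using (id; _∘_)

≤-refl : ∀ {x} → x ≤ x
≤-refl {zero}  = ≤-zero
≤-refl {suc x} = ≤-suc ≤-refl
≤-refl {lim f} = ≤-limiting λ k → ≤-cocone k ≤-refl

≤-sucʳ : ∀ x → x ≤ suc x
≤-sucʳ zero    = ≤-zero
≤-sucʳ (suc x) = ≤-suc (≤-sucʳ x)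
≤-sucʳ (lim f) = ≤-limiting λ k → ≤-trans (≤-sucʳ (f k)) (≤-suc (≤-cocone k ≤-refl))

<⇒≤ : ∀ {x y} → x < y → x ≤ y
<⇒≤ {x} x<y = ≤-trans (≤-sucʳ x) x<y

≈-refl : ∀ {x} → x ≈ x
≈-refl = ≤-refl , ≤-refl

≈-sym : ∀ {x y} → x ≈ y → y ≈ x
≈-sym (p , q) = q , p

≈-trans : ∀ {x y z} → x ≈ y → y ≈ z → x ≈ z
≈-trans (p , q) (p′ , q′) = ≤-trans p p′ , ≤-trans q′ q

IsLimit-resp-≈ : ∀ {x y} → IsLimit x → x ≈ y → IsLimit y
IsLimit-resp-≈ (x≉0 , x≉suc) x≈y =
  (λ y≈0 → x≉0 (≈-trans x≈y y≈0)) , (λ β y≈sβ → x≉suc β (≈-trans x≈y y≈sβ))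

-- The inductive order has a transitivity constructor, so it cannot be
-- inverted directly.  The recursive order ≤ʳ computes on the shapes of
-- both trees; it is equivalent to ≤ and yields the inversions we need.

_≤ʳ_ : Ord → Ord → Set
_<ʳ_ : Ord → Ord → Set
zero  ≤ʳ y = ⊤
suc x ≤ʳ y = x <ʳ y
lim f ≤ʳ y = ∀ k → f k ≤ʳ y
x <ʳ zero  = ⊥
x <ʳ suc y = x ≤ʳ y
x <ʳ lim f = ∃ λ k → x <ʳ f k

≤ʳ-cocone : ∀ x f k → x ≤ʳ f k → x ≤ʳ lim f
≤ʳ-cocone zero    f k p = tt
≤ʳ-cocone (suc x) f k p = k , p
≤ʳ-cocone (lim g) f k p = λ j → ≤ʳ-cocone (g j) f k (p j)

≤ʳ-trans : ∀ x y z → x ≤ʳ y → y ≤ʳ z → x ≤ʳ z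
<≤ʳ-trans : ∀ x y z → x <ʳ y → y ≤ʳ z → x <ʳ z
≤<ʳ-trans : ∀ x y z → x ≤ʳ y → y <ʳ z → x <ʳ z
≤ʳ-trans zero    y z p q = tt
≤ʳ-trans (suc x) y z p q = <≤ʳ-trans x y z p q
≤ʳ-trans (lim f) y z p q = λ k → ≤ʳ-trans (f k) y z (p k) q
<≤ʳ-trans x zero    z () q
<≤ʳ-trans x (suc y) z p q = ≤<ʳ-trans x y z p q
<≤ʳ-trans x (lim g) z (k , p) q = <≤ʳ-trans x (g k) z p (q k)
≤<ʳ-trans x y zero    p ()
≤<ʳ-trans x y (suc z) p q = ≤ʳ-trans x y z p q
≤<ʳ-trans x y (lim h) p (k , q) = k , ≤<ʳ-trans x y (h k) p q

≤⇒≤ʳ : ∀ {x y} → x ≤ y → x ≤ʳ y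
≤⇒≤ʳ ≤-zero                    = tt
≤⇒≤ʳ (≤-suc p)                 = ≤⇒≤ʳ p
≤⇒≤ʳ (≤-cocone {x} {f} k p)    = ≤ʳ-cocone x f k (≤⇒≤ʳ p)
≤⇒≤ʳ (≤-limiting h)            = λ k → ≤⇒≤ʳ (h k)
≤⇒≤ʳ (≤-trans {x} {y} {z} p q) = ≤ʳ-trans x y z (≤⇒≤ʳ p) (≤⇒≤ʳ q)

≤ʳ⇒≤ : ∀ x y → x ≤ʳ y → x ≤ y
<ʳ⇒< : ∀ x y → x <ʳ y → x < y
≤ʳ⇒≤ zero    y p = ≤-zero
≤ʳ⇒≤ (suc x) y p = <ʳ⇒< x y p
≤ʳ⇒≤ (lim f) y p = ≤-limiting λ k → ≤ʳ⇒≤ (f k) y (p k)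
<ʳ⇒< x zero    ()
<ʳ⇒< x (suc y) p       = ≤-suc (≤ʳ⇒≤ x y p)
<ʳ⇒< x (lim g) (k , p) = ≤-cocone k (<ʳ⇒< x (g k) p)

suc-injective : ∀ {x y} → suc x ≤ suc y → x ≤ y
suc-injective {x} {y} p = ≤ʳ⇒≤ x y (≤⇒≤ʳ p)

<lim-inversion : ∀ {x f} → x < lim f → ∃ λ k → x < f k
<lim-inversion {x} {f} p with ≤⇒≤ʳ p
... | k , q = k , <ʳ⇒< x (f k) q

infix 4 _≅_ _⊆_ _≺_

_≅_ : Fam → Fam → Set
F ≅ G = ∀ s → (F s → G s) × (G s → F s)

≅-refl : ∀ {F} → F ≅ F
≅-refl s = id , id

≅-sym : ∀ {F G} → F ≅ G → G ≅ F
≅-sym F≅G s = proj₂ (F≅G s) , proj₁ (F≅G s)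

≅-trans : ∀ {F G H} → F ≅ G → G ≅ H → F ≅ H
≅-trans F≅G G≅H s = proj₁ (G≅H s) ∘ proj₁ (F≅G s) , proj₂ (F≅G s) ∘ proj₂ (G≅H s)

_⊆_ : Subset → Subset → Set
M ⊆ N = ∀ m → M m → N m

⟨⟩-cong : ∀ {F G} u → F ≅ G → F ⟨ u ⟩ ≅ G ⟨ u ⟩
⟨⟩-cong u F≅G s =
  (λ (f , u≺s) → proj₁ (F≅G (u ++ s)) f , u≺s) , (λ (g , u≺s) → proj₂ (F≅G (u ++ s)) g , u≺s)

/-mono : ∀ {M N} u → M ⊆ N → M / u ⊆ N / u
/-mono u M⊆N m (Mm , u<m) = M⊆N m Mm , u<m

⟨[]⟩ : ∀ F → F ≅ F ⟨ [] ⟩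
⟨[]⟩ F s = (λ f → f , []) , proj₁

_≺_ : List ℕ → List ℕ → Set
v ≺ w = All (λ a → All (a <ℕ_) w) v

/⇒≺ : ∀ {N} v w → All (N / v) w → v ≺ w
/⇒≺ []      w _   = []
/⇒≺ (a ∷ v) w N/w = All.map (All.head ∘ proj₂) N/w ∷ /⇒≺ v w (All.map (λ (Nm , av<m) → Nm , All.tail av<m) N/w)

≺-++ : ∀ {w s} v → v ≺ w → v ≺ s → v ≺ w ++ s
≺-++ []      []            []            = []
≺-++ (a ∷ v) (a<w ∷ v≺w) (a<s ∷ v≺s) = Allₚ.++⁺ a<w a<s ∷ ≺-++ v v≺w v≺s

⟨⟩-++ : ∀ F v w → v ≺ w → F ⟨ v ⟩ ⟨ w ⟩ ≅ F ⟨ v ++ w ⟩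
⟨⟩-++ F v w v≺w s = to , from
  where
  to : (F ⟨ v ⟩ ⟨ w ⟩) s → (F ⟨ v ++ w ⟩) s
  to ((f , v≺ws) , w≺s) = subst F (sym (++-assoc v w s)) f , Allₚ.++⁺ (All.map (Allₚ.++⁻ʳ w) v≺ws) w≺s
  from : (F ⟨ v ++ w ⟩) s → (F ⟨ v ⟩ ⟨ w ⟩) s
  from (f , vw≺s) = (subst F (++-assoc v w s) f , ≺-++ v v≺w (Allₚ.++⁻ˡ v vw≺s)) , Allₚ.++⁻ʳ v vw≺s

/-++ : ∀ M v w → (M / v) / w ⊆ M / (v ++ w)
/-++ M v w m ((Mm , v<m) , w<m) = Mm , Allₚ.++⁺ v<m w<m

/-++⁻ : ∀ M v w → M / (v ++ w) ⊆ (M / v) / w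
/-++⁻ M v w m (Mm , vw<m) = (Mm , Allₚ.++⁻ˡ v vw<m) , Allₚ.++⁻ʳ v vw<m

maxSuc-++ : ∀ v w → maxSuc (v ++ w) ≡ maxSuc v ⊔ maxSuc w
maxSuc-++ []      w = refl
maxSuc-++ (a ∷ v) w = trans (cong (suc a ⊔_) (maxSuc-++ v w)) (sym (ℕₚ.⊔-assoc (suc a) (maxSuc v) (maxSuc w)))

All<⇒maxSuc≤ : ∀ {m} u → All (_<ℕ m) u → maxSuc u ≤ℕ m
All<⇒maxSuc≤ []      []          = z≤n
All<⇒maxSuc≤ (a ∷ u) (a<m ∷ u<m) = ℕₚ.⊔-lub a<m (All<⇒maxSuc≤ u u<m)

maxSuc≤⇒All< : ∀ {m} u → maxSuc u ≤ℕ m → All (_<ℕ m) u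
maxSuc≤⇒All< []      _ = []
maxSuc≤⇒All< (a ∷ u) p =
  ℕₚ.m⊔n≤o⇒m≤o (suc a) (maxSuc u) p ∷ maxSuc≤⇒All< u (ℕₚ.m⊔n≤o⇒n≤o (suc a) (maxSuc u) p)

/-Seg : ∀ {s M} v → M ⊆ Seg s → M / v ⊆ Seg (s ⊔ maxSuc v)
/-Seg v M⊆S m (Mm , v<m) = ℕₚ.⊔-lub (M⊆S m Mm) (All<⇒maxSuc≤ v v<m)

Seg⊆/ : ∀ s v → Seg (s ⊔ maxSuc v) ⊆ Seg s / v
Seg⊆/ s v m p = ℕₚ.m⊔n≤o⇒m≤o s (maxSuc v) p , maxSuc≤⇒All< v (ℕₚ.m⊔n≤o⇒n≤o s (maxSuc v) p)

Infinite-/ : ∀ {M} u → Infinite M → Infinite (M / u)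
Infinite-/ u infM k with infM (k ⊔ maxSuc u)
... | n , k⊔u<n , Mn =
  n , ℕₚ.≤-<-trans (ℕₚ.m≤m⊔n k (maxSuc u)) k⊔u<n ,
  Mn , maxSuc≤⇒All< u (ℕₚ.<⇒≤ (ℕₚ.≤-<-trans (ℕₚ.m≤n⊔m k (maxSuc u)) k⊔u<n))

Infinite-Seg : ∀ s → Infinite (Seg s)
Infinite-Seg s k = suc (k ⊔ s) , s≤s (ℕₚ.m≤m⊔n k s) , ℕₚ.≤-trans (ℕₚ.m≤n⊔m k s) (ℕₚ.n≤1+n _)

Increasing-++ : ∀ {v w} → Increasing v → Increasing w → v ≺ w → Increasing (v ++ w)
Increasing-++ []              inc-w _                = inc-w
Increasing-++ {w = []}    [-] inc-w _                = [-]
Increasing-++ {w = _ ∷ _} [-] inc-w (a<w ∷ [])       = All.head a<w ∷ inc-w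
Increasing-++ (a<b ∷ inc-v)   inc-w (_ ∷ v≺w)        = a<b ∷ Increasing-++ inc-v inc-w v≺w

Increasing-head : ∀ {n u} → Increasing (n ∷ u) → All (n <ℕ_) u
Increasing-head [-]           = []
Increasing-head (n<m ∷ inc-u) = n<m ∷ All.map (ℕₚ.<-trans n<m) (Increasing-head inc-u)

Uniform-transport : ∀ {M F β N G β′} → Uniform M F β →
  N ⊆ M → Infinite N → F ≅ G → β ≈ β′ → Uniform N G β′
Uniform-transport (uni0 β≈0 F⊆[] F[]) N⊆M infN F≅G β≈β′ =
  uni0 (≈-trans (≈-sym β≈β′) β≈0) (λ s Gs → F⊆[] s (proj₂ (F≅G s) Gs)) (proj₁ (F≅G []) F[])
Uniform-transport (uniS γ β≈sγ ¬F[] sections) N⊆M infN F≅G β≈β′ =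
  uniS γ (≈-trans (≈-sym β≈β′) β≈sγ) (¬F[] ∘ proj₂ (F≅G []))
    λ n Nn → Uniform-transport (sections n (N⊆M n Nn)) (/-mono (n ∷ []) N⊆M)
               (Infinite-/ (n ∷ []) infN) (⟨⟩-cong (n ∷ []) F≅G) ≈-refl
Uniform-transport {M} {N = N} (uniL βs lim-β ¬F[] incr sup sections) N⊆M infN F≅G β≈β′ =
  uniL βs (IsLimit-resp-≈ lim-β β≈β′) (¬F[] ∘ proj₂ (F≅G []))
    (λ k l Nk Nl → incr k l (N⊆M k Nk) (N⊆M l Nl))
    ((λ k Nk → ≤-trans (proj₁ sup k (N⊆M k Nk)) (proj₁ β≈β′)) ,
     (λ γ bound → ≤-trans (proj₂ β≈β′) (proj₂ sup γ (boundOnM γ bound))))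
    λ k Nk → Uniform-transport (sections k (N⊆M k Nk)) (/-mono (k ∷ []) N⊆M)
               (Infinite-/ (k ∷ []) infN) (⟨⟩-cong (k ∷ []) F≅G) ≈-refl
  where
  -- βs is increasing and N is cofinal in M, so bounds on N bound M.
  boundOnM : ∀ γ → (∀ k → N k → βs k ≤ γ) → ∀ k → M k → βs k ≤ γ
  boundOnM γ bound k Mk with infN k
  ... | m , k<m , Nm = ≤-trans (<⇒≤ (incr k m Mk (N⊆M m Nm) k<m)) (bound m Nm)

Uniform-inhabited : ∀ {B G γ} → Uniform B G γ → Infinite B → Σ (List ℕ) G
Uniform-inhabited (uni0 _ _ G[]) infB = [] , G[]
Uniform-inhabited (uniS _ _ _ sections) infB with infB 0
... | n , _ , Bn with Uniform-inhabited (sections n Bn) (Infinite-/ (n ∷ []) infB)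
...   | s , (Gns , _) = n ∷ s , Gns
Uniform-inhabited (uniL _ _ _ _ _ sections) infB with infB 0
... | n , _ , Bn with Uniform-inhabited (sections n Bn) (Infinite-/ (n ∷ []) infB)
...   | s , (Gns , _) = n ∷ s , Gns

rank-mono : ∀ {B G γ A G′ γ′} → Uniform B G γ → Uniform A G′ γ′ →
  B ⊆ A → Infinite B → G ≅ G′ → γ ≤ γ′
rank-mono (uni0 γ≈0 _ _) _ _ _ _ = ≤-trans (proj₁ γ≈0) ≤-zero
rank-mono (uniS _ _ ¬G[] _) (uni0 _ _ G′[]) _ _ G≅G′ = ⊥-elim (¬G[] (proj₂ (G≅G′ []) G′[]))
rank-mono (uniL _ _ ¬G[] _ _ _) (uni0 _ _ G′[]) _ _ G≅G′ = ⊥-elim (¬G[] (proj₂ (G≅G′ []) G′[]))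
rank-mono (uniS a γ≈sa _ sections) (uniS b γ′≈sb _ sections′) B⊆A infB G≅G′ with infB 0
... | n , _ , Bn =
  ≤-trans (proj₁ γ≈sa) (≤-trans (≤-suc (rank-mono (sections n Bn) (sections′ n (B⊆A n Bn))
    (/-mono (n ∷ []) B⊆A) (Infinite-/ (n ∷ []) infB) (⟨⟩-cong (n ∷ []) G≅G′))) (proj₂ γ′≈sb))
rank-mono (uniS a γ≈sa _ sections) (uniL βs′ _ _ incr′ sup′ sections′) B⊆A infB G≅G′ with infB 0
... | n , _ , Bn with infB n
...   | m , n<m , Bm =
  ≤-trans (proj₁ γ≈sa) (≤-trans (≤-suc (rank-mono (sections n Bn) (sections′ n (B⊆A n Bn))
    (/-mono (n ∷ []) B⊆A) (Infinite-/ (n ∷ []) infB) (⟨⟩-cong (n ∷ []) G≅G′)))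
    (≤-trans (incr′ n m (B⊆A n Bn) (B⊆A m Bm) n<m) (proj₁ sup′ m (B⊆A m Bm))))
rank-mono (uniL βs _ _ _ sup sections) (uniS b γ′≈sb _ sections′) B⊆A infB G≅G′ =
  ≤-trans (proj₂ sup (suc b) λ k Bk →
    ≤-trans (rank-mono (sections k Bk) (sections′ k (B⊆A k Bk)) (/-mono (k ∷ []) B⊆A)
      (Infinite-/ (k ∷ []) infB) (⟨⟩-cong (k ∷ []) G≅G′)) (≤-sucʳ b)) (proj₂ γ′≈sb)
rank-mono (uniL βs _ _ _ sup sections) (uniL βs′ _ _ _ sup′ sections′) B⊆A infB G≅G′ =
  proj₂ sup _ λ k Bk →
    ≤-trans (rank-mono (sections k Bk) (sections′ k (B⊆A k Bk)) (/-mono (k ∷ []) B⊆A)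
      (Infinite-/ (k ∷ []) infB) (⟨⟩-cong (k ∷ []) G≅G′)) (proj₁ sup′ k (B⊆A k Bk))

-- The sections of a uniform family of nonzero rank have strictly smaller
-- rank.  Nonzero rank is witnessed by a member of F starting with n.
section-rank : ∀ {A F α n} → Uniform A F α → Infinite A → A n → Σ (List ℕ) (λ s → F (n ∷ s)) →
  Σ Ord λ γ → γ < α × Uniform (A / (n ∷ [])) (F ⟨ n ∷ [] ⟩) γ
section-rank (uni0 _ F⊆[] _) _ _ (s , Fns) with F⊆[] _ Fns
... | ()
section-rank (uniS γ α≈sγ _ sections) _ An _ = γ , proj₂ α≈sγ , sections _ An
section-rank {n = n} (uniL βs _ _ incr sup sections) infA An _ with infA n
... | m , n<m , Am = βs n , ≤-trans (incr n m An Am n<m) (proj₁ sup m Am) , sections n An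

section-witness : ∀ {B G γ F n u} → Uniform B G γ → Infinite B → G ≅ F ⟨ n ∷ u ⟩ →
  Σ (List ℕ) (λ s → F (n ∷ s))
section-witness {u = u} uB infB G≅F with Uniform-inhabited uB infB
... | s , Gs = u ++ s , proj₁ (proj₁ (G≅F s) Gs)

-- By induction on u, using F_{n ∪ u} = (F_n)_u.
rank-drop : ∀ {A F α} → Uniform A F α → Infinite A → ∀ n u → A n → All A u → Increasing (n ∷ u) →
  ∀ {B G γ} → Uniform B G γ → B ⊆ A / (n ∷ u) → Infinite B → G ≅ F ⟨ n ∷ u ⟩ → γ < α
rank-drop {F = F} uA infA n [] An _ _ uB B⊆A infB G≅F with section-rank uA infA An (section-witness {F = F} uB infB G≅F)
... | γ₀ , γ₀<α , uₙ = ≤-trans (≤-suc (rank-mono uB uₙ B⊆A infB G≅F)) γ₀<α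
rank-drop {A} {F} uA infA n (n′ ∷ u) An Au inc {G = G} uB B⊆A infB G≅F
  with section-rank uA infA An (section-witness {F = F} uB infB G≅F)
... | γ₀ , γ₀<α , uₙ =
  ≤-trans (rank-drop uₙ (Infinite-/ (n ∷ []) infA) n′ u (All.head Au′) (All.tail Au′) (Linked.tail inc)
             uB (λ m → /-++⁻ A (n ∷ []) (n′ ∷ u) m ∘ B⊆A m) infB G≅Fₙ)
          (<⇒≤ γ₀<α)
  where
  n<u : All (n <ℕ_) (n′ ∷ u)
  n<u = Increasing-head inc
  Au′ : All (A / (n ∷ [])) (n′ ∷ u)
  Au′ = All.zipWith (λ (Am , n<m) → Am , n<m ∷ []) (Au , n<u)
  G≅Fₙ : G ≅ F ⟨ n ∷ [] ⟩ ⟨ n′ ∷ u ⟩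
  G≅Fₙ = ≅-trans G≅F (≅-sym (⟨⟩-++ F (n ∷ []) (n′ ∷ u) (n<u ∷ [])))

TSub-transport : ∀ {F G M N n} → F ≅ G → M ⊆ N → TSub F n M → TSub G n N
TSub-transport {n = n} F≅G M⊆N (k , Ft , t⊆M) = k , proj₁ (F≅G (interval n k)) Ft , All.map (M⊆N _) t⊆M

Adequate-transport : ∀ {γ γ′ s F G M N} → Adequate γ s F M →
  γ ≈ γ′ → F ≅ G → M ⊆ N → N ⊆ M → Adequate γ′ s G N
InAdq-transport : ∀ {γ γ′ s F G M N n} → InAdq γ s F M n →
  γ ≈ γ′ → F ≅ G → M ⊆ N → N ⊆ M → InAdq γ′ s G N n
InAdq-transport {n = n} (in2 γ≈2 Mn t⊆M) γ≈γ′ F≅G M⊆N N⊆M =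
  in2 (≈-trans (≈-sym γ≈γ′) γ≈2) (M⊆N n Mn) (TSub-transport F≅G M⊆N t⊆M)
InAdq-transport {F = F} {G} {n = n} (inS δ γ≈sδ 2≤δ Mn t⊆M adequate infinite) γ≈γ′ F≅G M⊆N N⊆M =
  inS δ (≈-trans (≈-sym γ≈γ′) γ≈sδ) 2≤δ (M⊆N n Mn) (TSub-transport F≅G M⊆N t⊆M)
    (Adequate-transport adequate ≈-refl Fₙ≅Gₙ (/-mono (n ∷ []) M⊆N) (/-mono (n ∷ []) N⊆M))
    λ k → let (m , k<m , m∈) = infinite k in
      m , k<m , InAdq-transport m∈ ≈-refl Fₙ≅Gₙ (/-mono (n ∷ []) M⊆N) (/-mono (n ∷ []) N⊆M)
  where
  Fₙ≅Gₙ : F ⟨ n ∷ [] ⟩ ≅ G ⟨ n ∷ [] ⟩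
  Fₙ≅Gₙ = ⟨⟩-cong (n ∷ []) F≅G
InAdq-transport {n = n} (inL lim-γ Mn) γ≈γ′ F≅G M⊆N N⊆M = inL (IsLimit-resp-≈ lim-γ γ≈γ′) (M⊆N n Mn)
Adequate-transport (ad2 n γ≈2 n∈) γ≈γ′ F≅G M⊆N N⊆M =
  ad2 n (≈-trans (≈-sym γ≈γ′) γ≈2) (InAdq-transport n∈ γ≈γ′ F≅G M⊆N N⊆M)
Adequate-transport (adS n δ γ≈sδ 2≤δ n∈) γ≈γ′ F≅G M⊆N N⊆M =
  adS n δ (≈-trans (≈-sym γ≈γ′) γ≈sδ) 2≤δ (InAdq-transport n∈ γ≈γ′ F≅G M⊆N N⊆M)
Adequate-transport {s = s} (adL lim-γ witness) γ≈γ′ F≅G M⊆N N⊆M =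
  adL (IsLimit-resp-≈ lim-γ γ≈γ′) λ ξ ξ<γ′ →
    let (v , v≢[] , inc-v , v⊆M , δ , ξ≤δ , uniform , adequate) = witness ξ (≤-trans ξ<γ′ (proj₂ γ≈γ′))
    in v , v≢[] , inc-v , All.map (M⊆N _) v⊆M , δ , ξ≤δ ,
       Uniform-transport uniform (λ _ → id) (Infinite-Seg (s ⊔ maxSuc v)) (⟨⟩-cong v F≅G) ≈-refl ,
       Adequate-transport adequate ≈-refl (⟨⟩-cong v F≅G) (/-mono v M⊆N) (/-mono v N⊆M)

record Fundamental (s : ℕ) (α : Ord) : Set where
  field
    seq       : ℕ → Ord
    seq<α     : ∀ k → Seg s k → seq k < α
    seq-least : ∀ γ → (∀ k → Seg s k → seq k ≤ γ) → α ≤ γ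

fundamental : ∀ {s F α} → Uniform (Seg s) F α → IsLimit α → Fundamental s α
fundamental (uni0 α≈0 _ _) (α≉0 , _) = ⊥-elim (α≉0 α≈0)
fundamental (uniS γ α≈sγ _ _) (_ , α≉suc) = ⊥-elim (α≉suc γ α≈sγ)
fundamental (uniL βs _ _ incr sup _) _ = record
  { seq       = βs
  ; seq<α     = λ k sk → let sk′ = ℕₚ.≤-trans sk (ℕₚ.n≤1+n k) in
                  ≤-trans (incr k (suc k) sk sk′ (ℕₚ.n<1+n k)) (proj₁ sup (suc k) sk′)
  ; seq-least = proj₂ sup
  }

interpolate : ∀ {s α ξ} → Fundamental s α → ξ < α → Σ Ord λ ξ′ → ξ < ξ′ × ξ′ < α
interpolate {s} {α} {ξ} fund ξ<α = seq (s + j) , ξ<seq , seq<α (s + j) (ℕₚ.m≤m+n s j)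
  where
  open Fundamental fund
  α≤tail : α ≤ lim (λ j → seq (s + j))
  α≤tail = seq-least _ λ k sk →
    ≤-cocone (k ∸ s) (subst (λ i → seq k ≤ seq i) (sym (ℕₚ.m+[n∸m]≡n sk)) ≤-refl)
  below-tail : ∃ λ j → ξ < seq (s + j)
  below-tail = <lim-inversion (≤-trans ξ<α α≤tail)
  j : ℕ
  j = proj₁ below-tail
  ξ<seq : ξ < seq (s + j)
  ξ<seq = proj₂ below-tail

record Descent (δ : Ord) (s : ℕ) (G : Fam) (N : Subset) (ξ : Ord) : Set₁ where
  field
    u            : List ℕ
    β            : Ord
    u-increasing : Increasing u
    u⊆N          : All N u
    ξ≤β          : ξ ≤ β
    β<δ          : β < δ
    adequate     : Adequate (suc β) (s ⊔ maxSuc u) (G ⟨ u ⟩) (N / u)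
    uniform      : Uniform (N / u) (G ⟨ u ⟩) (suc β)

descend-successor : ∀ {δ β s G N ξ} → Adequate δ s G N → Uniform (Seg s) G δ →
  N ⊆ Seg s → Infinite N → δ ≈ suc β → ξ < δ → Descent δ s G N ξ
descend-successor {β = β} {s} {G} {N} adequate uniform N⊆S infN δ≈sβ ξ<δ = record
  { u = [] ; β = β ; u-increasing = [] ; u⊆N = []
  ; ξ≤β = suc-injective (≤-trans ξ<δ (proj₁ δ≈sβ))
  ; β<δ = proj₂ δ≈sβ
  ; adequate = subst (λ t → Adequate (suc β) t (G ⟨ [] ⟩) (N / [])) (sym (ℕₚ.⊔-identityʳ s))
      (Adequate-transport adequate δ≈sβ (⟨[]⟩ G) (λ _ Nm → Nm , []) (λ _ → proj₁))
  ; uniform = Uniform-transport uniform (λ m → N⊆S m ∘ proj₁) (Infinite-/ [] infN) (⟨[]⟩ G) δ≈sβ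
  }

descend-prepend : ∀ {δ δ′ s G N ξ} v → Infinite N → Increasing v → All N v → δ′ ≤ δ →
  Descent δ′ (s ⊔ maxSuc v) (G ⟨ v ⟩) (N / v) ξ → Descent δ s G N ξ
descend-prepend {s = s} {G} {N} v infN inc-v v⊆N δ′≤δ d = record
  { u = v ++ u ; β = β
  ; u-increasing = Increasing-++ inc-v u-increasing v≺u
  ; u⊆N = Allₚ.++⁺ v⊆N (All.map proj₁ u⊆N)
  ; ξ≤β = ξ≤β
  ; β<δ = ≤-trans β<δ δ′≤δ
  ; adequate = subst (λ t → Adequate (suc β) t (G ⟨ v ++ u ⟩) (N / (v ++ u))) maxSuc-assoc
      (Adequate-transport adequate ≈-refl (⟨⟩-++ G v u v≺u) (/-++ N v u) (/-++⁻ N v u))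
  ; uniform = Uniform-transport uniform (/-++⁻ N v u) (Infinite-/ (v ++ u) infN) (⟨⟩-++ G v u v≺u) ≈-refl
  }
  where
  open Descent d
  v≺u : v ≺ u
  v≺u = /⇒≺ v u u⊆N
  maxSuc-assoc : (s ⊔ maxSuc v) ⊔ maxSuc u ≡ s ⊔ maxSuc (v ++ u)
  maxSuc-assoc = trans (ℕₚ.⊔-assoc s (maxSuc v) (maxSuc u)) (cong (s ⊔_) (sym (maxSuc-++ v u)))

section-rank-Seg : ∀ {s G δ δ′} v → Uniform (Seg s) G δ → ¬ v ≡ [] → Increasing v → All (Seg s) v →
  Uniform (Seg (s ⊔ maxSuc v)) (G ⟨ v ⟩) δ′ → δ′ < δ
section-rank-Seg []      _ v≢[] = ⊥-elim (v≢[] refl)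
section-rank-Seg {s} (n ∷ v) uniform _ inc (sn ∷ v⊆S) uniformᵥ =
  rank-drop uniform (Infinite-Seg s) n v sn v⊆S inc uniformᵥ (Seg⊆/ s (n ∷ v)) (Infinite-Seg _) ≅-refl

-- Descent lemma.  At a limit rank, pick ξ < ξ′ < δ; adequacy gives v
-- with G_v of rank δ′ ≥ ξ′ and N/v G_v-adequate; descend there.
descend : ∀ {δ s G N} → Adequate δ s G N → Uniform (Seg s) G δ → N ⊆ Seg s → Infinite N →
  ∀ ξ → ξ < δ → Descent δ s G N ξ
descend adequate@(ad2 _ δ≈2 _) uniform N⊆S infN ξ ξ<δ =
  descend-successor adequate uniform N⊆S infN δ≈2 ξ<δ
descend adequate@(adS _ _ δ≈sδ′ _ _) uniform N⊆S infN ξ ξ<δ =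
  descend-successor adequate uniform N⊆S infN δ≈sδ′ ξ<δ
descend (adL lim-δ witness) uniform N⊆S infN ξ ξ<δ
  with interpolate (fundamental uniform lim-δ) ξ<δ
... | ξ′ , ξ<ξ′ , ξ′<δ with witness ξ′ ξ′<δ
... | v , v≢[] , inc-v , v⊆N , δ′ , ξ′≤δ′ , uniformᵥ , adequateᵥ =
  descend-prepend v infN inc-v v⊆N
    (<⇒≤ (section-rank-Seg v uniform v≢[] inc-v (All.map (N⊆S _) v⊆N) uniformᵥ))
    (descend adequateᵥ uniformᵥ (/-Seg v N⊆S) (Infinite-/ v infN) ξ (≤-trans ξ<ξ′ ξ′≤δ′))

mainTheorem15 : (α : Ord) (s0 : ℕ) (F : Fam) (M : Subset) →
  IsLimit α →
  Uniform (Seg s0) F α →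
  (∀ m → M m → s0 ≤ℕ m) → Infinite M →
  Adequate α s0 F M →
  Σ (ℕ → Ord) λ βs → Σ (ℕ → List ℕ) λ us →
    (∀ n → βs n < α) ×
    (∀ n → Increasing (us n) × All M (us n) ×
           Adequate (suc (βs n)) (s0 ⊔ maxSuc (us n)) (F ⟨ us n ⟩) (M / us n) ×
           Uniform (M / us n) (F ⟨ us n ⟩) (suc (βs n))) ×
    IsSupOn (λ _ → ⊤) βs α
mainTheorem15 α s0 F M lim-α F-uniform M⊆S infM M-adequate =
  Descent.β ∘ descent , Descent.u ∘ descent ,
  Descent.β<δ ∘ descent ,
  (λ n → let open Descent (descent n) in u-increasing , u⊆N , adequate , uniform) ,
  (λ n _ → <⇒≤ (Descent.β<δ (descent n))) ,
  (λ γ bound → seq-least γ λ k sk → ≤-trans (seq≤β k sk) (bound (k ∸ s0) tt))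
  where
  open Fundamental (fundamental F-uniform lim-α)
  descent : ∀ n → Descent α s0 F M (seq (s0 + n))
  descent n = descend M-adequate F-uniform M⊆S infM (seq (s0 + n)) (seq<α (s0 + n) (ℕₚ.m≤m+n s0 n))
  seq≤β : ∀ k → Seg s0 k → seq k ≤ Descent.β (descent (k ∸ s0))
  seq≤β k sk = subst (λ i → seq i ≤ Descent.β (descent (k ∸ s0))) (ℕₚ.m+[n∸m]≡n sk)
                 (Descent.ξ≤β (descent (k ∸ s0)))
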